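{- Let $(D=(V,A),\mathcal F)$ be a digraft, and let $\mathcal C$ be the closure of $\mathcal F$ for $(D,\mathcal F)$. Then $\mathcal F\subseteq \mathcal C$, and $\mathcal C$ is a crossing family, i.e. $U\cap W\in\mathcal C$ and $U\cup W\in\mathcal C$ for all $U,W\in\mathcal C$ with $U\cap W\neq\emptyset$ and $U\cup W\neq V$.
   Context: $\delta^+(W),\delta^-(W)$ are arcs leaving/entering $W$; $x(S)=\sum_{a\in S}x_a$. A dicut is $\delta^+(W)$ with $\emptyset\ne W\subsetneq V$, $\delta^-(W)=\emptyset$. $\mathrm{dij}(D)=\{x\ge0:x(\delta^+(W))\ge1$ for every dicut$\}$. A digraph is bipartite if every node is a source or a sink. A digraft is a pair $(D,\mathcal F)$ with $D=(V,A)$ bipartite with $2$-edge-connected underlying undirected graph, and $\mathcal F$ a family of subsets of $V$ with (a) $\emptyset,V\notin\mathcal F$, (b) $\delta^-(W)=\emptyset$ for $W\in\mathcal F$, (c) $V\setminus\{v\}\in\mathcal F$ for every sink $v$, (d) $F(D,\mathcal F):=\mathrm{dij}(D)\cap\{x:x(\delta^+(W))=1\ \forall W\in\mathcal F\}\neq\emptyset$. The closure of $\mathcal F$ for $(D,\mathcal F)$ is the family of all $U$ with $\emptyset\ne U\subsetneq V$, $\delta^-(U)=\emptyset$ and $F(D,\mathcal F)\subseteq\{x:x(\delta^+(U))=1\}$.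
   Formalization: The vectors x in $\mathrm{dij}(D)$, in the face $F(D,\mathcal F)$ and in the closure of 𝓕 have rational entries. -}

module Defs where

open import Data.Nat using (ℕ; _≤_)
open import Data.Bool using (_≟_; Bool; true; false; if_then_else_; _∧_; not)
open import Data.Fin using (Fin)
open import Data.Fin.Subset using (Subset; _∈_; _∉_; _∩_; _∪_; _-_; ⊥; ⊤; Nonempty)
open import Data.Vec using (lookup)
open import Data.List using (List; map; foldr; allFin; filter; length)
open import Data.Rational using (ℚ; 0ℚ; 1ℚ; _+_) renaming (_≤_ to _≤ℚ_)
open import Data.Product using (Σ; ∃; _×_; _,_)
open import Data.Sum using (_⊎_)
open import Relation.Nullary using (¬_)
open import Relation.Binary.PropositionalEquality using (_≡_)

record Digraph : Set where
  field
    n    : ℕ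
    m    : ℕ
    tail : Fin m → Fin n
    head : Fin m → Fin n
open Digraph public

module _ (D : Digraph) where

  NonemptyProper : Subset (n D) → Set
  NonemptyProper W = Nonempty W × ∃ λ v → v ∉ W

  leaves? : Subset (n D) → Fin (m D) → Bool
  leaves? W a = lookup W (tail D a) ∧ not (lookup W (head D a))

  NoEntering : Subset (n D) → Set
  NoEntering W = (a : Fin (m D)) → ¬ (head D a ∈ W × tail D a ∉ W)

  DicutShore : Subset (n D) → Set
  DicutShore W = NonemptyProper W × NoEntering W

  outSum : (Fin (m D) → ℚ) → Subset (n D) → ℚ
  outSum x W = foldr _+_ 0ℚ (map (λ a → if leaves? W a then x a else 0ℚ) (allFin (m D)))

  InDij : (Fin (m D) → ℚ) → Set
  InDij x = ((a : Fin (m D)) → 0ℚ ≤ℚ x a)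
          × ((W : Subset (n D)) → DicutShore W → 1ℚ ≤ℚ outSum x W)

  InFace : (Subset (n D) → Set) → (Fin (m D) → ℚ) → Set
  InFace 𝓕 x = InDij x × ((W : Subset (n D)) → 𝓕 W → outSum x W ≡ 1ℚ)

  IsSource IsSink : Fin (n D) → Set
  IsSource v = (a : Fin (m D)) → ¬ (head D a ≡ v)
  IsSink   v = (a : Fin (m D)) → ¬ (tail D a ≡ v)

  Bipartite : Set
  Bipartite = (v : Fin (n D)) → IsSource v ⊎ IsSink v

  crosses? : Subset (n D) → Fin (m D) → Bool
  crosses? W a = if lookup W (tail D a) then not (lookup W (head D a)) else lookup W (head D a)

  TwoEdgeConnected : Set
  TwoEdgeConnected = (W : Subset (n D)) → NonemptyProper W →
                     2 ≤ length (filter (λ a → crosses? W a ≟ true) (allFin (m D)))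

  Closure : (Subset (n D) → Set) → Subset (n D) → Set
  Closure 𝓕 U = NonemptyProper U × NoEntering U
              × ((x : Fin (m D) → ℚ) → InFace 𝓕 x → outSum x U ≡ 1ℚ)

  record IsDigraft (𝓕 : Subset (n D) → Set) : Set where
    field
      bipartite   : Bipartite
      twoEdgeConn : TwoEdgeConnected
      emptyNotIn  : ¬ 𝓕 ⊥
      fullNotIn   : ¬ 𝓕 ⊤
      noEntering  : (W : Subset (n D)) → 𝓕 W → NoEntering W
      sinkCompl   : (v : Fin (n D)) → IsSink v → 𝓕 (⊤ - v)
      faceNonempty : ∃ λ x → InFace 𝓕 x

CrossingFamily : {k : ℕ} → (Subset k → Set) → Set
CrossingFamily {k} 𝓒 = (U W : Subset k) → 𝓒 U → 𝓒 W →
  Nonempty (U ∩ W) → (∃ λ v → v ∉ (U ∪ W)) → 𝓒 (U ∩ W) × 𝓒 (U ∪ W)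

{-# OPTIONS --safe #-}
-- On node sets that no arc enters, x ↦ x(δ⁺(U)) is modular:
-- x(δ⁺(U)) + x(δ⁺(W)) = x(δ⁺(U ∩ W)) + x(δ⁺(U ∪ W)).  If U and W are tight
-- (value 1) at a point x of the face and U ∩ W, U ∪ W are dicut shores, both
-- have value ≥ 1 in dij(D) while their values sum to 2, so both are tight.
-- Only axioms (a) and (b) of a digraft are needed.
module Submission where

open import Defs
open import Data.Fin.Subset using (Subset)
open import Data.Product using (_×_)

open import Algebra.Bundles using (CommutativeMonoid)
import Algebra.Properties.CommutativeSemigroup as CommutativeSemigroupProperties
open import Data.Bool using (Bool; true; false; _∧_; _∨_; not; if_then_else_)
open import Data.Bool.Base using (f≤t; b≤b) renaming (_≤_ to _≤ᵇ_)
open import Data.Bool.Properties using (≤-minimum; ≤-reflexive)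
open import Data.Fin using (Fin)
open import Data.Fin.Subset using (_∈_; _∉_; _∩_; _∪_; ∁; ⊥; ⊤; Nonempty)
open import Data.Fin.Subset.Properties
  using (_∈?_; nonempty?; Empty-unique; x∈∁p⇒x∉p; p∪∁p≡⊤; ∪-identityʳ; x∈p∩q⁺; x∈p∩q⁻; x∈p∪q⁺; x∈p∪q⁻)
open import Data.List using (List; []; _∷_; map; foldr; allFin)
open import Data.List.Properties using (map-cong)
open import Data.Product using (∃; _,_; proj₁; proj₂; map₂)
open import Data.Rational using (ℚ; 0ℚ; 1ℚ; _+_; _≤_)
open import Data.Rational.Properties using (+-comm; +-0-commutativeMonoid; ≤-antisym; ≮⇒≥; <-irrefl; +-mono-<-≤; +-mono-≤-<)
open import Data.Sum using (inj₁; inj₂)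
open import Data.Vec.Properties using (lookup-zipWith; []=⇒lookup; lookup⇒[]=)
open import Data.Vec using (lookup)
open import Function using (_∘_; _∘₂_)
open import Relation.Nullary using (¬_; yes; no; contradiction)
open import Relation.Nullary.Decidable using (decidable-stable)
open import Relation.Binary.PropositionalEquality using (_≡_; _≢_; refl; sym; cong; cong₂; subst; module ≡-Reasoning)

module _ {c ℓ} (M : CommutativeMonoid c ℓ) where
  open CommutativeMonoid M
  open CommutativeSemigroupProperties commutativeSemigroup using (interchange)
  open import Relation.Binary.Reasoning.Setoid setoid

  foldr-map-∙-distrib : ∀ {a} {A : Set a} (f g : A → Carrier) (xs : List A) →
    foldr _∙_ ε (map f xs) ∙ foldr _∙_ ε (map g xs) ≈ foldr _∙_ ε (map (λ y → f y ∙ g y) xs)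
  foldr-map-∙-distrib f g []       = identityˡ ε
  foldr-map-∙-distrib f g (y ∷ xs) = begin
    (f y ∙ foldr _∙_ ε (map f xs)) ∙ (g y ∙ foldr _∙_ ε (map g xs))
      ≈⟨ interchange (f y) _ (g y) _ ⟩
    (f y ∙ g y) ∙ (foldr _∙_ ε (map f xs) ∙ foldr _∙_ ε (map g xs))
      ≈⟨ ∙-congˡ (foldr-map-∙-distrib f g xs) ⟩
    (f y ∙ g y) ∙ foldr _∙_ ε (map (λ z → f z ∙ g z) xs) ∎

≢⊥⇒Nonempty : ∀ {k} {p : Subset k} → p ≢ ⊥ → Nonempty p
≢⊥⇒Nonempty {p = p} p≢⊥ = decidable-stable (nonempty? p) (p≢⊥ ∘ Empty-unique)

≢⊤⇒∃∉ : ∀ {k} {p : Subset k} → p ≢ ⊤ → ∃ λ x → x ∉ p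
≢⊤⇒∃∉ {p = p} p≢⊤ = map₂ x∈∁p⇒x∉p (≢⊥⇒Nonempty ∁p≢⊥)
  where
  open ≡-Reasoning
  ∁p≢⊥ : ∁ p ≢ ⊥
  ∁p≢⊥ ∁p≡⊥ = p≢⊤ (begin
    p       ≡⟨ sym (∪-identityʳ p) ⟩
    p ∪ ⊥   ≡⟨ cong (p ∪_) (sym ∁p≡⊥) ⟩
    p ∪ ∁ p ≡⟨ p∪∁p≡⊤ p ⟩
    ⊤       ∎)

lower-bounds-tight : ∀ {p q r s : ℚ} → p ≤ r → q ≤ s → r + s ≡ p + q → r ≡ p × s ≡ q
lower-bounds-tight {p} {q} {r} {s} p≤r q≤s r+s≡p+q =
  ≤-antisym (≮⇒≥ (λ p<r → <-irrefl p+q≡r+s (+-mono-<-≤ p<r q≤s))) p≤r ,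
  ≤-antisym (≮⇒≥ (λ q<s → <-irrefl p+q≡r+s (+-mono-≤-< p≤r q<s))) q≤s
  where
  p+q≡r+s : p + q ≡ r + s
  p+q≡r+s = sym r+s≡p+q

if-modular : ∀ {tU hU tW hW : Bool} → hU ≤ᵇ tU → hW ≤ᵇ tW → (q : ℚ) →
  (if tU ∧ not hU then q else 0ℚ) + (if tW ∧ not hW then q else 0ℚ) ≡
  (if (tU ∧ tW) ∧ not (hU ∧ hW) then q else 0ℚ) + (if (tU ∨ tW) ∧ not (hU ∨ hW) then q else 0ℚ)
if-modular f≤t            f≤t            q = refl
if-modular f≤t            (b≤b {false})  q = +-comm q 0ℚ
if-modular f≤t            (b≤b {true})   q = refl
if-modular (b≤b {false})  f≤t            q = refl
if-modular (b≤b {false})  (b≤b {false})  q = refl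
if-modular (b≤b {false})  (b≤b {true})   q = refl
if-modular (b≤b {true})   f≤t            q = +-comm 0ℚ q
if-modular (b≤b {true})   (b≤b {false})  q = refl
if-modular (b≤b {true})   (b≤b {true})   q = refl

module _ (D : Digraph) where

  NoEntering⇒tail∈ : ∀ {S} → NoEntering D S → ∀ a → head D a ∈ S → tail D a ∈ S
  NoEntering⇒tail∈ {S} noEnt a head∈S with tail D a ∈? S
  ... | yes tail∈S = tail∈S
  ... | no  tail∉S = contradiction (head∈S , tail∉S) (noEnt a)

  NoEntering⇒head≤tail : ∀ {S} → NoEntering D S → ∀ a → lookup S (head D a) ≤ᵇ lookup S (tail D a)
  NoEntering⇒head≤tail {S} noEnt a with lookup S (head D a) in head∈S
  ... | false = ≤-minimum _
  ... | true  = ≤-reflexive (sym ([]=⇒lookup (NoEntering⇒tail∈ noEnt a (lookup⇒[]= _ S head∈S))))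

  NoEntering-∩ : ∀ {U W} → NoEntering D U → NoEntering D W → NoEntering D (U ∩ W)
  NoEntering-∩ {U} {W} noEntU noEntW a (head∈U∩W , tail∉U∩W) =
    let head∈U , head∈W = x∈p∩q⁻ U W head∈U∩W
    in tail∉U∩W (x∈p∩q⁺ (NoEntering⇒tail∈ noEntU a head∈U , NoEntering⇒tail∈ noEntW a head∈W))

  NoEntering-∪ : ∀ {U W} → NoEntering D U → NoEntering D W → NoEntering D (U ∪ W)
  NoEntering-∪ {U} {W} noEntU noEntW a (head∈U∪W , tail∉U∪W) with x∈p∪q⁻ U W head∈U∪W
  ... | inj₁ head∈U = tail∉U∪W (x∈p∪q⁺ (inj₁ (NoEntering⇒tail∈ noEntU a head∈U)))
  ... | inj₂ head∈W = tail∉U∪W (x∈p∪q⁺ (inj₂ (NoEntering⇒tail∈ noEntW a head∈W)))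

  DicutShore-∩ : ∀ {U W} → DicutShore D U → DicutShore D W → Nonempty (U ∩ W) → DicutShore D (U ∩ W)
  DicutShore-∩ {U} {W} ((_ , v , v∉U) , noEntU) (_ , noEntW) U∩W-nonempty =
    (U∩W-nonempty , v , v∉U ∘ proj₁ ∘ x∈p∩q⁻ U W) , NoEntering-∩ noEntU noEntW

  DicutShore-∪ : ∀ {U W} → DicutShore D U → DicutShore D W → (∃ λ v → v ∉ U ∪ W) → DicutShore D (U ∪ W)
  DicutShore-∪ {U} {W} (((u , u∈U) , _) , noEntU) (_ , noEntW) U∪W-proper =
    ((u , x∈p∪q⁺ (inj₁ u∈U)) , U∪W-proper) , NoEntering-∪ noEntU noEntW

  -- Without entering arcs, every arc leaves as many of U, W as of U ∩ W, U ∪ W.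
  outSum-modular : ∀ {U W} → NoEntering D U → NoEntering D W → (x : Fin (m D) → ℚ) →
    outSum D x U + outSum D x W ≡ outSum D x (U ∩ W) + outSum D x (U ∪ W)
  outSum-modular {U} {W} noEntU noEntW x = begin
    outSum D x U + outSum D x W
      ≡⟨ Σ-distrib (term U) (term W) ⟩
    Σ (λ a → term U a + term W a)
      ≡⟨ cong (foldr _+_ 0ℚ) (map-cong term-modular (allFin (m D))) ⟩
    Σ (λ a → term (U ∩ W) a + term (U ∪ W) a)
      ≡⟨ sym (Σ-distrib (term (U ∩ W)) (term (U ∪ W))) ⟩
    outSum D x (U ∩ W) + outSum D x (U ∪ W) ∎
    where
    open ≡-Reasoning
    term : Subset (n D) → Fin (m D) → ℚ
    term S a = if leaves? D S a then x a else 0ℚ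
    Σ : (Fin (m D) → ℚ) → ℚ
    Σ f = foldr _+_ 0ℚ (map f (allFin (m D)))
    Σ-distrib : ∀ f g → Σ f + Σ g ≡ Σ (λ a → f a + g a)
    Σ-distrib f g = foldr-map-∙-distrib +-0-commutativeMonoid f g (allFin (m D))
    term-modular : ∀ a → term U a + term W a ≡ term (U ∩ W) a + term (U ∪ W) a
    term-modular a
      rewrite lookup-zipWith _∧_ (tail D a) U W | lookup-zipWith _∧_ (head D a) U W
            | lookup-zipWith _∨_ (tail D a) U W | lookup-zipWith _∨_ (head D a) U W
      = if-modular (NoEntering⇒head≤tail noEntU a) (NoEntering⇒head≤tail noEntW a) (x a)

  InDij-crossing-tight : ∀ {x U W} → InDij D x → DicutShore D (U ∩ W) → DicutShore D (U ∪ W) →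
    NoEntering D U → NoEntering D W → outSum D x U ≡ 1ℚ → outSum D x W ≡ 1ℚ →
    outSum D x (U ∩ W) ≡ 1ℚ × outSum D x (U ∪ W) ≡ 1ℚ
  InDij-crossing-tight {x} {U} {W} (_ , dicut≥1) shore∩ shore∪ noEntU noEntW U-tight W-tight =
    lower-bounds-tight (dicut≥1 (U ∩ W) shore∩) (dicut≥1 (U ∪ W) shore∪) (begin
      outSum D x (U ∩ W) + outSum D x (U ∪ W) ≡⟨ sym (outSum-modular noEntU noEntW x) ⟩
      outSum D x U + outSum D x W             ≡⟨ cong₂ _+_ U-tight W-tight ⟩
      1ℚ + 1ℚ                                 ∎)
    where open ≡-Reasoning

  Closure-crossing : (𝓕 : Subset (n D) → Set) → CrossingFamily (Closure D 𝓕)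
  Closure-crossing 𝓕 U W (U-proper , noEntU , U-tight) (W-proper , noEntW , W-tight) U∩W-nonempty U∪W-proper =
    (proj₁ shore∩ , proj₂ shore∩ , proj₁ ∘₂ tight) , (proj₁ shore∪ , proj₂ shore∪ , proj₂ ∘₂ tight)
    where
    shore∩ : DicutShore D (U ∩ W)
    shore∩ = DicutShore-∩ (U-proper , noEntU) (W-proper , noEntW) U∩W-nonempty
    shore∪ : DicutShore D (U ∪ W)
    shore∪ = DicutShore-∪ (U-proper , noEntU) (W-proper , noEntW) U∪W-proper
    tight : (x : Fin (m D) → ℚ) → InFace D 𝓕 x → outSum D x (U ∩ W) ≡ 1ℚ × outSum D x (U ∪ W) ≡ 1ℚ
    tight x x∈face =
      InDij-crossing-tight (proj₁ x∈face) shore∩ shore∪ noEntU noEntW (U-tight x x∈face) (W-tight x x∈face)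

  Closure-extensive : (𝓕 : Subset (n D) → Set) → ¬ 𝓕 ⊥ → ¬ 𝓕 ⊤ →
    ((W : Subset (n D)) → 𝓕 W → NoEntering D W) → (W : Subset (n D)) → 𝓕 W → Closure D 𝓕 W
  Closure-extensive 𝓕 ⊥∉𝓕 ⊤∉𝓕 noEnt W W∈𝓕 =
    (≢⊥⇒Nonempty W≢⊥ , ≢⊤⇒∃∉ W≢⊤) , noEnt W W∈𝓕 , λ x x∈face → proj₂ x∈face W W∈𝓕
    where
    W≢⊥ : W ≢ ⊥
    W≢⊥ W≡⊥ = ⊥∉𝓕 (subst 𝓕 W≡⊥ W∈𝓕)
    W≢⊤ : W ≢ ⊤
    W≢⊤ W≡⊤ = ⊤∉𝓕 (subst 𝓕 W≡⊤ W∈𝓕)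

mainTheorem17 : (D : Digraph) (𝓕 : Subset (n D) → Set) → IsDigraft D 𝓕 →
    ((W : Subset (n D)) → 𝓕 W → Closure D 𝓕 W) × CrossingFamily (Closure D 𝓕)
mainTheorem17 D 𝓕 digraft = Closure-extensive D 𝓕 emptyNotIn fullNotIn noEntering , Closure-crossing D 𝓕
  where open IsDigraft digraft
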